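{- For every positive integer $k$ and every graph $S$, there exist a graph $G$ containing $S$ as an induced subgraph and a configuration $C_0$ of $G$ such that the $\frac12$-power index process with initial configuration $C_0$ eventually becomes periodic with period at least $k$.
   Context: All graphs are finite and simple. A configuration of a graph $G$ is a map $C:V(G)\to\{C,D\}$; vertices with value $C$ are collaborators, those with value $D$ defectors. $N[v]$ is the closed neighbourhood of $v$, $N_C[v]$ is the set of collaborators in $N[v]$ and $N_D[v]$ the set of defectors in $N[v]$. For $w=\frac12$, the power of $v$ is: if $v$ is a collaborator, $p(v)=1/|N_C[v]|$ when $|N_C[v]|/|N[v]|>w$ and $0$ otherwise; if $v$ is a defector, $p(v)=1/|N_D[v]|$ when $|N_C[v]|/|N[v]|\le w$ and $0$ otherwise. The $w$-power index process produces $C_1,C_2,\dots$ from $C_0$: for $t\ge1$ each vertex $v$ simultaneously takes the strategy that, in $C_{t-1}$, is held by the vertex of $N[v]$ of greatest power (computed w.r.t. $C_{t-1}$); if the vertices of $N[v]$ of greatest power have differing strategies, $C_t(v)=C_{t-1}(v)$. The process becomes periodic with period $\ell$ if $\ell>1$ is the least integer such that $C_i=C_{i+\ell}$ for some $i\ge0$. -}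

module Defs where

open import Data.Bool using (Bool; true; false; T; if_then_else_)
open import Data.Nat using (ℕ; zero; suc; _<_; _≤_)
open import Data.Integer using (+_)
open import Data.Rational using (ℚ; _/_; ½; 0ℚ; _⊔_)
open import Data.Rational.Properties using (_≟_; _<?_)
open import Data.Fin using (Fin)
open import Data.List using (List; _∷_; []; filter; length; map; foldr)
open import Data.Vec.Functional using (Vector)
open import Data.Product using (Σ; ∃; _×_)
open import Relation.Nullary using (¬_; does)
open import Relation.Binary.PropositionalEquality using (_≡_)
open import Function.Definitions using (Injective)
open import Data.List using (allFin)

record Graph (n : ℕ) : Set where
  field
    adj       : Fin n → Fin n → Bool
    symmetric : ∀ u v → adj u v ≡ adj v u
    irrefl    : ∀ v → adj v v ≡ false
open Graph public

data Strat : Set where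
  C D : Strat

isC : Strat → Bool
isC C = true
isC D = false

isD : Strat → Bool
isD C = false
isD D = true

Config : ℕ → Set
Config n = Fin n → Strat

-- Closed neighbourhood N[v] = v together with its neighbours (adj is irreflexive,
-- so v is not repeated).
N[_] : ∀ {n} → Graph n → Fin n → List (Fin n)
N[ G ] v = v ∷ filter (λ u → T? (adj G v u)) (allFin _)
  where
  open import Relation.Nullary.Decidable using () renaming (T? to T?₀)
  T? = T?₀

sizeN : ∀ {n} → Graph n → Fin n → ℕ
sizeN G v = suc (length (filter (λ u → T? (adj G v u)) (allFin _)))
  where open import Relation.Nullary.Decidable using (T?)

countC : ∀ {n} → Graph n → Config n → Fin n → ℕ
countC G c v = length (filter (λ u → T? (isC (c u))) (N[ G ] v))
  where open import Relation.Nullary.Decidable using (T?)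

countD : ∀ {n} → Graph n → Config n → Fin n → ℕ
countD G c v = length (filter (λ u → T? (isD (c u))) (N[ G ] v))
  where open import Relation.Nullary.Decidable using (T?)

-- 1/m (with the value 0 for m = 0, which never occurs where used)
inv : ℕ → ℚ
inv zero    = 0ℚ
inv (suc m) = + 1 / suc m

fracC : ∀ {n} → Graph n → Config n → Fin n → ℚ
fracC G c v = (+ countC G c v) / sizeN G v

power : ∀ {n} → Graph n → Config n → Fin n → ℚ
power G c v with c v
... | C = if does (½ <? fracC G c v) then inv (countC G c v) else 0ℚ
... | D = if does (½ <? fracC G c v) then 0ℚ else inv (countD G c v)

maxPower : ∀ {n} → Graph n → Config n → Fin n → ℚ
maxPower G c v = foldr _⊔_ (power G c v) (map (power G c) (N[ G ] v))

bestStrats : ∀ {n} → Graph n → Config n → Fin n → List Strat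
bestStrats G c v =
  map c (filter (λ u → power G c u ≟ maxPower G c v) (N[ G ] v))

allB : {A : Set} → (A → Bool) → List A → Bool
allB p []       = true
allB p (x ∷ xs) = if p x then allB p xs else false

step : ∀ {n} → Graph n → Config n → Config n
step G c v =
  if allB isC (bestStrats G c v) then C
  else if allB isD (bestStrats G c v) then D
  else c v

process : ∀ {n} → Graph n → Config n → ℕ → Config n
process G c zero    = c
process G c (suc t) = step G (process G c t)

SameConfig : ∀ {n} → Config n → Config n → Set
SameConfig c c' = ∀ v → c v ≡ c' v

Recurs : ∀ {n} → Graph n → Config n → ℕ → Set
Recurs G c ℓ = ∃ λ i → SameConfig (process G c i) (process G c (i Data.Nat.+ ℓ))

PeriodIs : ∀ {n} → Graph n → Config n → ℕ → Set
PeriodIs G c ℓ = (1 < ℓ) × Recurs G c ℓ × (∀ m → 1 < m → m < ℓ → ¬ Recurs G c m)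

InducedSubgraph : ∀ {m n} → Graph m → Graph n → Set
InducedSubgraph {m} {n} S G =
  Σ (Fin m → Fin n) λ f → Injective _≡_ _≡_ f × (∀ u v → adj S u v ≡ adj G (f u) (f v))

-- Let L = k + 6 and glue to S, disjointly, the prism C_L □ K₃: each column of the prism is a triangle
-- and consecutive columns are joined row by row. Write the cyclic word X F₁ F₂ Y Z₁ Z₂ ⋯ Z₂ of length
-- L along the columns, where each letter prescribes the strategies of the three vertices of its column
-- (X = DDC, F₁ = F₂ = DDD, Y = CCD, Z₁ = Z₂ = CCC), and let S defect. A vertex's new strategy depends only
-- on the configuration within distance 2, so for a prism vertex it can be computed in the prism P₅ □ K₃
-- around its column; checking the sixteen five-letter windows of the word shows that every column takes
-- over the letter of the next one. Hence the word rotates by one column per step and the configuration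
-- has period exactly L, while the vertices of S, seeing only defectors, keep defecting.

module Submission where

open import Defs
open import Data.Bool using (Bool; true; false; T; _∧_; _∨_; not; if_then_else_)
open import Data.Bool.Properties using () renaming (_≟_ to _≟B_)
open import Data.Empty using (⊥-elim)
open import Data.Fin using (Fin; zero; suc; toℕ; #_; splitAt; join; _↑ˡ_; _↑ʳ_; combine; remQuot)
open import Data.Fin.Properties
  using (toℕ-fromℕ<; toℕ-injective; toℕ<n; all?; remQuot-combine; combine-remQuot; splitAt-↑ˡ; splitAt-↑ʳ;
         join-splitAt; ↑ˡ-injective; ↑ʳ-injective)
  renaming (_≟_ to _≟F_)
open import Data.List using (List; []; _∷_; map; filter; length; foldr; allFin)
open import Data.List.Properties using (length-map; map-∘; map-cong-local; map-id)
open import Data.List.Membership.Propositional using (_∈_)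
open import Data.List.Membership.Propositional.Properties using (∈-filter⁺; ∈-filter⁻; ∈-map⁺; ∈-map⁻; ∈-allFin)
open import Data.List.Relation.Unary.All as All using (All; []; _∷_)
import Data.List.Relation.Unary.All.Properties as All
open import Data.List.Relation.Unary.Any using (here; there)
open import Data.List.Relation.Unary.AllPairs using ([]; _∷_)
open import Data.List.Relation.Unary.Unique.Propositional using (Unique)
import Data.List.Relation.Unary.Unique.Propositional.Properties as Unique
open import Data.List.Membership.Propositional.Properties.WithK using (unique∧set⇒bag)
open import Data.List.Relation.Binary.BagAndSetEquality using (∼bag⇒↭)
open import Data.List.Relation.Binary.Permutation.Propositional using (_↭_; refl; prep; swap; trans; ↭-reflexive)
open import Data.List.Relation.Binary.Permutation.Propositional.Properties using (↭-length; filter-↭; map⁺)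
open import Data.Nat using (ℕ; zero; suc; _+_; _*_; _<_; _≤_; z≤n; s≤s; _%_; _≡ᵇ_)
open import Data.Nat.Properties
  using (suc-injective; m≤n⇒m<n∨m≡n; m≤n+m; +-assoc; +-comm; +-suc; +-identityʳ; *-suc; +-cancelˡ-≡; <⇒≢; <⇒≱; m≤m+n)
open import Data.Nat.DivMod
  using (_mod_; n%n≡0; %-distribˡ-+; m%n%n≡m%n; m<n⇒m%n≡m; [m+n]%n≡m%n; m*n%n≡0; m≡m%n+[m/n]*n)
  renaming (_/_ to _div_)
open import Data.Integer using (+_)
open import Data.Product using (Σ; ∃; _×_; _,_; proj₁; proj₂; uncurry)
open import Data.Rational using (ℚ; _⊔_; ½; 0ℚ) renaming (_/_ to _÷_)
open import Data.Rational.Properties using (⊔-comm; ⊔-assoc; ⊔-sel) renaming (_≟_ to _≟ℚ_; _<?_ to _<ℚ?_)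
open import Data.Sum using (_⊎_; inj₁; inj₂; [_,_]′)
open import Function using (_∘_; id; _⇔_; mk⇔; Equivalence)
open import Relation.Nullary using (¬_; Dec; does; yes; no)
open import Relation.Nullary.Decidable using (T?; toWitness; fromWitness; does-⇔; dec-false; isYes; isYes≗does)
open import Relation.Binary.PropositionalEquality
  using (_≡_; _≢_; refl; sym; cong; cong₂; subst; module ≡-Reasoning)
  renaming (trans to ≡-trans)

allB-↭ : ∀ {A : Set} (p : A → Bool) {xs ys} → xs ↭ ys → allB p xs ≡ allB p ys
allB-↭ p refl = refl
allB-↭ p (prep x q) rewrite allB-↭ p q = refl
allB-↭ p (swap x y q) rewrite allB-↭ p q with p x | p y
... | true  | true  = refl
... | true  | false = refl
... | false | true  = refl
... | false | false = refl
allB-↭ p (trans q r) = ≡-trans (allB-↭ p q) (allB-↭ p r)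

allB-false : ∀ {A : Set} (p : A → Bool) {x xs} → x ∈ xs → p x ≡ false → allB p xs ≡ false
allB-false p (here refl) px≡false rewrite px≡false = refl
allB-false p {xs = y ∷ _} (there x∈xs) px≡false with p y
... | true  = allB-false p x∈xs px≡false
... | false = refl

allB-true : ∀ {A : Set} (p : A → Bool) {xs} → All (λ x → p x ≡ true) xs → allB p xs ≡ true
allB-true p []            = refl
allB-true p (px ∷ pxs) rewrite px = allB-true p pxs

foldr-⊔-↭ : ∀ e {xs ys} → xs ↭ ys → foldr _⊔_ e xs ≡ foldr _⊔_ e ys
foldr-⊔-↭ e refl = refl
foldr-⊔-↭ e (prep x q) = cong (x ⊔_) (foldr-⊔-↭ e q)
foldr-⊔-↭ e {_ ∷ _ ∷ _} {_ ∷ _ ∷ ys} (swap x y q) rewrite foldr-⊔-↭ e q = begin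
  x ⊔ (y ⊔ m)   ≡⟨ ⊔-assoc x y m ⟨
  (x ⊔ y) ⊔ m   ≡⟨ cong (_⊔ m) (⊔-comm x y) ⟩
  (y ⊔ x) ⊔ m   ≡⟨ ⊔-assoc y x m ⟩
  y ⊔ (x ⊔ m)   ∎
  where open ≡-Reasoning
        m = foldr _⊔_ e ys
foldr-⊔-↭ e (trans q r) = ≡-trans (foldr-⊔-↭ e q) (foldr-⊔-↭ e r)

foldr-⊔-sel : ∀ e (ys : List ℚ) → foldr _⊔_ e ys ≡ e ⊎ foldr _⊔_ e ys ∈ ys
foldr-⊔-sel e [] = inj₁ refl
foldr-⊔-sel e (y ∷ ys) with ⊔-sel y (foldr _⊔_ e ys)
... | inj₁ eq = inj₂ (here eq)
... | inj₂ eq with foldr-⊔-sel e ys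
...   | inj₁ eq′ = inj₁ (≡-trans eq eq′)
...   | inj₂ mem = inj₂ (there (subst (_∈ ys) (sym eq) mem))

countBy : ∀ {A : Set} → (A → Bool) → List A → ℕ
countBy p xs = length (filter (λ u → T? (p u)) xs)

countBy-↭ : ∀ {A : Set} (p : A → Bool) {xs ys} → xs ↭ ys → countBy p xs ≡ countBy p ys
countBy-↭ p q = ↭-length (filter-↭ (λ u → T? (p u)) q)

countBy-map : ∀ {A B : Set} {p : A → Bool} {q : B → Bool} (f : B → A) →
  (∀ z → p (f z) ≡ q z) → ∀ zs → countBy p (map f zs) ≡ countBy q zs
countBy-map f p∘f≗q [] = refl
countBy-map {q = q} f p∘f≗q (z ∷ zs) rewrite p∘f≗q z with q z
... | true  = cong suc (countBy-map f p∘f≗q zs)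
... | false = countBy-map f p∘f≗q zs

map-filter-map : ∀ {A B X : Set} (f : A → B) {g : B → ℚ} {h : A → ℚ} {c : B → X} {d : A → X} →
  (∀ z → c (f z) ≡ d z) → ∀ M {xs} → All (λ z → g (f z) ≡ h z) xs →
  map c (filter (λ u → g u ≟ℚ M) (map f xs)) ≡ map d (filter (λ u → h u ≟ℚ M) xs)
map-filter-map f c∘f≗d M [] = refl
map-filter-map f {h = h} c∘f≗d M {x ∷ xs} (e ∷ es) rewrite e with h x ≟ℚ M
... | yes _ = cong₂ _∷_ (c∘f≗d x) (map-filter-map f c∘f≗d M es)
... | no _  = map-filter-map f c∘f≗d M es

unique-⇔⇒↭ : ∀ {A : Set} {xs ys : List A} → Unique xs → Unique ys → (∀ {x} → x ∈ xs ⇔ x ∈ ys) → xs ↭ ys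
unique-⇔⇒↭ xs-unique ys-unique same = ∼bag⇒↭ (unique∧set⇒bag xs-unique ys-unique same)

∈-N[] : ∀ {n} (G : Graph n) {u v} → u ∈ N[ G ] v ⇔ (u ≡ v ⊎ T (adj G v u))
∈-N[] {n} G {u} {v} = mk⇔ to from
  where
  to : u ∈ N[ G ] v → u ≡ v ⊎ T (adj G v u)
  to (here refl)   = inj₁ refl
  to (there u∈nbs) = inj₂ (proj₂ (∈-filter⁻ (λ w → T? (adj G v w)) {xs = allFin n} u∈nbs))
  from : u ≡ v ⊎ T (adj G v u) → u ∈ N[ G ] v
  from (inj₁ refl) = here refl
  from (inj₂ v~u)  = there (∈-filter⁺ (λ w → T? (adj G v w)) (∈-allFin u) v~u)

N[]-unique : ∀ {n} (G : Graph n) v → Unique (N[ G ] v)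
N[]-unique {n} G v = All.tabulate v∉nbs ∷ Unique.filter⁺ (λ u → T? (adj G v u)) (Unique.allFin⁺ n)
  where
  v∉nbs : ∀ {u} → u ∈ filter (λ u → T? (adj G v u)) (allFin n) → v ≢ u
  v∉nbs u∈nbs refl = subst T (irrefl G v) (proj₂ (∈-filter⁻ (λ u → T? (adj G v u)) {xs = allFin n} u∈nbs))

module _ {m n} (G : Graph m) (H : Graph n) where

  adj⊎ : Fin m ⊎ Fin n → Fin m ⊎ Fin n → Bool
  adj⊎ (inj₁ a) (inj₁ b) = adj G a b
  adj⊎ (inj₂ p) (inj₂ q) = adj H p q
  adj⊎ (inj₁ _) (inj₂ _) = false
  adj⊎ (inj₂ _) (inj₁ _) = false

  adj⊎-sym : ∀ x y → adj⊎ x y ≡ adj⊎ y x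
  adj⊎-sym (inj₁ a) (inj₁ b) = symmetric G a b
  adj⊎-sym (inj₂ p) (inj₂ q) = symmetric H p q
  adj⊎-sym (inj₁ _) (inj₂ _) = refl
  adj⊎-sym (inj₂ _) (inj₁ _) = refl

  adj⊎-irrefl : ∀ x → adj⊎ x x ≡ false
  adj⊎-irrefl (inj₁ a) = irrefl G a
  adj⊎-irrefl (inj₂ p) = irrefl H p

  _⊕_ : Graph (m + n)
  _⊕_ = record
    { adj       = λ u v → adj⊎ (splitAt m u) (splitAt m v)
    ; symmetric = λ u v → adj⊎-sym (splitAt m u) (splitAt m v)
    ; irrefl    = λ u → adj⊎-irrefl (splitAt m u)
    }

  ⊕-adjˡˡ : ∀ a b → adj _⊕_ (a ↑ˡ n) (b ↑ˡ n) ≡ adj G a b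
  ⊕-adjˡˡ a b = cong₂ adj⊎ (splitAt-↑ˡ m a n) (splitAt-↑ˡ m b n)

  ⊕-adjʳʳ : ∀ p q → adj _⊕_ (m ↑ʳ p) (m ↑ʳ q) ≡ adj H p q
  ⊕-adjʳʳ p q = cong₂ adj⊎ (splitAt-↑ʳ m n p) (splitAt-↑ʳ m n q)

  ⊕-adjˡʳ : ∀ a q → adj _⊕_ (a ↑ˡ n) (m ↑ʳ q) ≡ false
  ⊕-adjˡʳ a q = cong₂ adj⊎ (splitAt-↑ˡ m a n) (splitAt-↑ʳ m n q)

  ⊕-adjʳˡ : ∀ p b → adj _⊕_ (m ↑ʳ p) (b ↑ˡ n) ≡ false
  ⊕-adjʳˡ p b = cong₂ adj⊎ (splitAt-↑ʳ m n p) (splitAt-↑ˡ m b n)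

  ⊕-induced : InducedSubgraph G _⊕_
  ⊕-induced = (_↑ˡ n) , (λ {a} {b} → ↑ˡ-injective n a b) , (λ a b → sym (⊕-adjˡˡ a b))

data ⊕-View {m n} : Fin (m + n) → Set where
  left  : ∀ a → ⊕-View (a ↑ˡ n)
  right : ∀ p → ⊕-View (m ↑ʳ p)

⊕-view : ∀ {m n} (u : Fin (m + n)) → ⊕-View {m} {n} u
⊕-view {m} {n} u = subst ⊕-View (join-splitAt m n u) (view⊎ (splitAt m u))
  where
  view⊎ : (x : Fin m ⊎ Fin n) → ⊕-View (join m n x)
  view⊎ (inj₁ a) = left a
  view⊎ (inj₂ p) = right p

-- Locality of the update rule

degree : ∀ {n} → Graph n → Fin n → ℕ
degree G v = length (filter (λ u → T? (adj G v u)) (allFin _))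

powerFrom : Strat → ℕ → ℕ → ℕ → ℚ
powerFrom C nC nD deg = if does (½ <ℚ? (+ nC ÷ suc deg)) then inv nC else 0ℚ
powerFrom D nC nD deg = if does (½ <ℚ? (+ nC ÷ suc deg)) then 0ℚ else inv nD

power≡powerFrom : ∀ {n} (G : Graph n) c v →
  power G c v ≡ powerFrom (c v) (countC G c v) (countD G c v) (degree G v)
power≡powerFrom G c v = ≡-trans power≡playing (playing≡powerFrom (c v))
  where
  -- Matching on s keeps playing (c v) stuck, so that `with c v` below does not also abstract
  -- the occurrences of c v hidden inside countC G c v.
  playing : Strat → ℚ
  playing C = powerFrom C (countC G c v) (countD G c v) (degree G v)
  playing D = powerFrom D (countC G c v) (countD G c v) (degree G v)
  power≡playing : power G c v ≡ playing (c v)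
  power≡playing with c v
  ... | C = refl
  ... | D = refl
  playing≡powerFrom : ∀ s → playing s ≡ powerFrom s (countC G c v) (countD G c v) (degree G v)
  playing≡powerFrom C = refl
  playing≡powerFrom D = refl

powerFrom-cong : ∀ {s s′ nC nC′ nD nD′ deg deg′} → s ≡ s′ → nC ≡ nC′ → nD ≡ nD′ → deg ≡ deg′ →
  powerFrom s nC nD deg ≡ powerFrom s′ nC′ nD′ deg′
powerFrom-cong refl refl refl refl = refl

NeighbourhoodPreserved : ∀ {n t} → Graph n → Graph t → (Fin t → Fin n) → Fin t → Set
NeighbourhoodPreserved G H f w = N[ G ] (f w) ↭ map f (N[ H ] w)

-- The strategy adopted by f w depends only on the configuration within distance 2 of f w,
-- so it can be computed in any graph H mapping onto that region with the same closed neighbourhoods.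
module Transport {n t} (G : Graph n) (c : Config n) (H : Graph t) (d : Config t)
                 (f : Fin t → Fin n) (c∘f≗d : ∀ u → c (f u) ≡ d u) where

  power-transport : ∀ w → NeighbourhoodPreserved G H f w → power G c (f w) ≡ power H d w
  power-transport w N↭ = begin
    power G c (f w)
      ≡⟨ power≡powerFrom G c (f w) ⟩
    powerFrom (c (f w)) (countC G c (f w)) (countD G c (f w)) (degree G (f w))
      ≡⟨ powerFrom-cong (c∘f≗d w) sameC sameD sameDegree ⟩
    powerFrom (d w) (countC H d w) (countD H d w) (degree H w)
      ≡⟨ power≡powerFrom H d w ⟨
    power H d w
      ∎
    where
    open ≡-Reasoning
    sameC : countC G c (f w) ≡ countC H d w
    sameC = ≡-trans (countBy-↭ (isC ∘ c) N↭) (countBy-map {p = isC ∘ c} f (cong isC ∘ c∘f≗d) (N[ H ] w))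
    sameD : countD G c (f w) ≡ countD H d w
    sameD = ≡-trans (countBy-↭ (isD ∘ c) N↭) (countBy-map {p = isD ∘ c} f (cong isD ∘ c∘f≗d) (N[ H ] w))
    sameDegree : degree G (f w) ≡ degree H w
    sameDegree = suc-injective (≡-trans (↭-length N↭) (length-map f (N[ H ] w)))

  bestStrats-transport : ∀ w → All (NeighbourhoodPreserved G H f) (N[ H ] w) →
                         bestStrats G c (f w) ↭ bestStrats H d w
  bestStrats-transport w preserved@(N↭ ∷ _) =
    subst (bestStrats G c (f w) ↭_) sameBest (map⁺ c (filter-↭ (λ u → power G c u ≟ℚ maxPower G c (f w)) N↭))
    where
    powers : All (λ z → power G c (f z) ≡ power H d z) (N[ H ] w)
    powers = All.map (λ {z} → power-transport z) preserved
    sameMax : maxPower G c (f w) ≡ maxPower H d w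
    sameMax = ≡-trans (foldr-⊔-↭ _ (map⁺ (power G c) N↭))
      (cong₂ (foldr _⊔_) (power-transport w N↭)
             (≡-trans (sym (map-∘ {g = power G c} {f = f} (N[ H ] w))) (map-cong-local powers)))
    sameBest : map c (filter (λ u → power G c u ≟ℚ maxPower G c (f w)) (map f (N[ H ] w))) ≡ bestStrats H d w
    sameBest = ≡-trans (cong (λ M → map c (filter (λ u → power G c u ≟ℚ M) (map f (N[ H ] w)))) sameMax)
                       (map-filter-map f {g = power G c} c∘f≗d (maxPower H d w) powers)

  step-transport : ∀ w → All (NeighbourhoodPreserved G H f) (N[ H ] w) → step G c (f w) ≡ step H d w
  step-transport w preserved
    rewrite allB-↭ isC (bestStrats-transport w preserved)
          | allB-↭ isD (bestStrats-transport w preserved)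
          | c∘f≗d w = refl

step-cong : ∀ {n} (G : Graph n) {c c′ : Config n} → (∀ u → c u ≡ c′ u) → ∀ v → step G c v ≡ step G c′ v
step-cong G c≗c′ v = Transport.step-transport G _ G _ id c≗c′ v
  (All.tabulate (λ {w} _ → ↭-reflexive (sym (map-id (N[ G ] w)))))

step-unanimousD : ∀ {n} (G : Graph n) c v → All (λ u → c u ≡ D) (N[ G ] v) → step G c v ≡ D
step-unanimousD G c v allD =
  step≡D (allB-false isC D∈best refl) (allB-true isD (All.map (cong isD) best-allD))
  where
  step≡D : allB isC (bestStrats G c v) ≡ false → allB isD (bestStrats G c v) ≡ true → step G c v ≡ D
  step≡D notAllC allD′ rewrite notAllC | allD′ = refl
  M = maxPower G c v
  best-allD : All (_≡ D) (bestStrats G c v)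
  best-allD = All.map⁺ (All.filter⁺ (λ u → power G c u ≟ℚ M) allD)
  maxAttained : ∃ λ u → u ∈ N[ G ] v × power G c u ≡ M
  maxAttained with foldr-⊔-sel (power G c v) (map (power G c) (N[ G ] v))
  ... | inj₁ eq = v , here refl , sym eq
  ... | inj₂ mem with ∈-map⁻ (power G c) mem
  ...   | u , u∈N , eq = u , u∈N , sym eq
  D∈best : D ∈ bestStrats G c v
  D∈best with maxAttained
  ... | u , u∈N , eq = subst (_∈ bestStrats G c v) (All.lookup allD u∈N)
                             (∈-map⁺ c (∈-filter⁺ (λ u → power G c u ≟ℚ M) u∈N eq))

-- Rotations of a cycle

module Rotation (l : ℕ) where

  L : ℕ
  L = suc l

  rotate : ℕ → Fin L → Fin L
  rotate a i = (toℕ i + a) mod L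

  toℕ-rotate : ∀ a i → toℕ (rotate a i) ≡ (toℕ i + a) % L
  toℕ-rotate a i = toℕ-fromℕ< _

  [x%L+a]%L≡[x+a]%L : ∀ x a → (x % L + a) % L ≡ (x + a) % L
  [x%L+a]%L≡[x+a]%L x a = begin
    (x % L + a) % L             ≡⟨ %-distribˡ-+ (x % L) a L ⟩
    ((x % L) % L + a % L) % L   ≡⟨ cong (λ z → (z + a % L) % L) (m%n%n≡m%n x L) ⟩
    (x % L + a % L) % L         ≡⟨ %-distribˡ-+ x a L ⟨
    (x + a) % L                 ∎
    where open ≡-Reasoning

  rotate-rotate : ∀ a b i → rotate a (rotate b i) ≡ rotate (b + a) i
  rotate-rotate a b i = toℕ-injective (begin
    toℕ (rotate a (rotate b i))   ≡⟨ toℕ-rotate a (rotate b i) ⟩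
    (toℕ (rotate b i) + a) % L    ≡⟨ cong (λ z → (z + a) % L) (toℕ-rotate b i) ⟩
    ((toℕ i + b) % L + a) % L     ≡⟨ [x%L+a]%L≡[x+a]%L (toℕ i + b) a ⟩
    (toℕ i + b + a) % L           ≡⟨ cong (_% L) (+-assoc (toℕ i) b a) ⟩
    (toℕ i + (b + a)) % L         ≡⟨ toℕ-rotate (b + a) i ⟨
    toℕ (rotate (b + a) i)        ∎)
    where open ≡-Reasoning

  rotate-zero : ∀ i → rotate 0 i ≡ i
  rotate-zero i = toℕ-injective (begin
    toℕ (rotate 0 i)     ≡⟨ toℕ-rotate 0 i ⟩
    (toℕ i + 0) % L      ≡⟨ cong (_% L) (+-identityʳ (toℕ i)) ⟩
    toℕ i % L            ≡⟨ m<n⇒m%n≡m (toℕ<n i) ⟩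
    toℕ i                ∎)
    where open ≡-Reasoning

  rotate-L : ∀ i → rotate L i ≡ i
  rotate-L i = toℕ-injective (begin
    toℕ (rotate L i)     ≡⟨ toℕ-rotate L i ⟩
    (toℕ i + L) % L      ≡⟨ [m+n]%n≡m%n (toℕ i) L ⟩
    toℕ i % L            ≡⟨ m<n⇒m%n≡m (toℕ<n i) ⟩
    toℕ i                ∎)
    where open ≡-Reasoning

  rotate-≢ : ∀ {a} i → 0 < a → a < L → rotate a i ≢ i
  rotate-≢ {a} i 0<a a<L rotate-a-i≡i = notMultiple q (+-cancelˡ-≡ (toℕ i) a (q * L) i+a≡i+qL)
    where
    q : ℕ
    q = (toℕ i + a) div L
    i+a≡i+qL : toℕ i + a ≡ toℕ i + q * L
    i+a≡i+qL = ≡-trans (m≡m%n+[m/n]*n (toℕ i + a) L)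
                 (cong (_+ q * L) (≡-trans (sym (toℕ-rotate a i)) (cong toℕ rotate-a-i≡i)))
    notMultiple : ∀ k → a ≢ k * L
    notMultiple zero    a≡0    = <⇒≢ 0<a (sym a≡0)
    notMultiple (suc k) a≡L+kL = <⇒≱ a<L (subst (L ≤_) (sym a≡L+kL) (m≤m+n L (k * L)))

  toℕ-rotate-zero : ∀ {a} → a < L → toℕ (rotate a zero) ≡ a
  toℕ-rotate-zero {a} a<L = ≡-trans (toℕ-rotate a zero) (m<n⇒m%n≡m a<L)

  unrotate : ℕ → Fin L
  unrotate t = rotate (t * l) zero

  rotate-unrotate : ∀ t → rotate t (unrotate t) ≡ zero
  rotate-unrotate t = toℕ-injective (begin
    toℕ (rotate t (unrotate t))       ≡⟨ cong toℕ (rotate-rotate t (t * l) zero) ⟩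
    toℕ (rotate (t * l + t) zero)     ≡⟨ toℕ-rotate (t * l + t) zero ⟩
    (t * l + t) % L                   ≡⟨ cong (_% L) (+-comm (t * l) t) ⟩
    (t + t * l) % L                   ≡⟨ cong (_% L) (*-suc t l) ⟨
    (t * L) % L                       ≡⟨ m*n%n≡0 t L ⟩
    0                                 ∎)
    where open ≡-Reasoning

  next prev : Fin L → Fin L
  next = rotate 1
  prev = rotate l

  next-prev : ∀ i → next (prev i) ≡ i
  next-prev i = ≡-trans (rotate-rotate 1 l i) (≡-trans (cong (λ a → rotate a i) (+-comm l 1)) (rotate-L i))

  prev-next : ∀ i → prev (next i) ≡ i
  prev-next i = ≡-trans (rotate-rotate l 1 i) (rotate-L i)

  toℕ-rotate-next : ∀ t i → toℕ (rotate t (next i)) ≡ suc (toℕ (rotate t i)) % L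
  toℕ-rotate-next t i = begin
    toℕ (rotate t (rotate 1 i))     ≡⟨ cong toℕ (rotate-rotate t 1 i) ⟩
    toℕ (rotate (suc t) i)          ≡⟨ toℕ-rotate (suc t) i ⟩
    (toℕ i + suc t) % L             ≡⟨ cong (_% L) (+-suc (toℕ i) t) ⟩
    suc (toℕ i + t) % L             ≡⟨ cong (_% L) (+-comm 1 (toℕ i + t)) ⟩
    (toℕ i + t + 1) % L             ≡⟨ [x%L+a]%L≡[x+a]%L (toℕ i + t) 1 ⟨
    ((toℕ i + t) % L + 1) % L       ≡⟨ cong (_% L) (+-comm ((toℕ i + t) % L) 1) ⟩
    suc ((toℕ i + t) % L) % L       ≡⟨ cong (λ z → suc z % L) (toℕ-rotate t i) ⟨
    suc (toℕ (rotate t i)) % L      ∎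
    where open ≡-Reasoning

  next≢ : 1 < L → ∀ i → next i ≢ i
  next≢ 1<L i = rotate-≢ i (s≤s z≤n) 1<L

  next²≢ : 2 < L → ∀ i → next (next i) ≢ i
  next²≢ 2<L i eq = rotate-≢ i (s≤s z≤n) 2<L (≡-trans (sym (rotate-rotate 1 1 i)) eq)

  prev≢ : 1 < L → ∀ i → prev i ≢ i
  prev≢ 1<L i eq = next≢ 1<L i (≡-trans (cong next (sym eq)) (next-prev i))

  prev≢next : 2 < L → ∀ i → prev i ≢ next i
  prev≢next 2<L i eq = next²≢ 2<L i (≡-trans (cong next (sym eq)) (next-prev i))

-- The travelling word

data Letter : Set where
  X F₁ F₂ Y Z₁ Z₂ : Letter

letter : ℕ → Letter
letter 0 = X
letter 1 = F₁
letter 2 = F₂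
letter 3 = Y
letter 4 = Z₁
letter _ = Z₂

data Follows : Letter → Letter → Set where
  X→F₁  : Follows X F₁
  F₁→F₂ : Follows F₁ F₂
  F₂→Y  : Follows F₂ Y
  Y→Z₁  : Follows Y Z₁
  Z₁→Z₂ : Follows Z₁ Z₂
  Z₂→Z₂ : Follows Z₂ Z₂
  Z₂→X  : Follows Z₂ X

letter-suc : ∀ r → Follows (letter r) (letter (suc r))
letter-suc 0 = X→F₁
letter-suc 1 = F₁→F₂
letter-suc 2 = F₂→Y
letter-suc 3 = Y→Z₁
letter-suc 4 = Z₁→Z₂
letter-suc (suc (suc (suc (suc (suc _))))) = Z₂→Z₂

column : Letter → Fin 3 → Strat
column X  zero             = D
column X  (suc zero)       = D
column X  (suc (suc zero)) = C
column F₁ _                = D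
column F₂ _                = D
column Y  zero             = C
column Y  (suc zero)       = C
column Y  (suc (suc zero)) = D
column Z₁ _                = C
column Z₂ _                = C

letter-suc-mod : ∀ K {a} → a < 6 + K → Follows (letter a) (letter (suc a % (6 + K)))
letter-suc-mod K {a} a<L with m≤n⇒m<n∨m≡n a<L
... | inj₁ 1+a<L rewrite m<n⇒m%n≡m 1+a<L = letter-suc a
... | inj₂ refl = subst (λ r → Follows Z₂ (letter r)) (sym (n%n≡0 (6 + K))) Z₂→X

-- The template is the prism P₅ □ K₃: vertex u of Fin 15 lies in column u / 3 and row u % 3.
templateAdj : ℕ → ℕ → Bool
templateAdj u v = ((u div 3 ≡ᵇ v div 3) ∧ not (u ≡ᵇ v)) ∨ ((u % 3 ≡ᵇ v % 3) ∧ ((u + 3 ≡ᵇ v) ∨ (v + 3 ≡ᵇ u)))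

template : Graph 15
template = record
  { adj       = λ u v → templateAdj (toℕ u) (toℕ v)
  ; symmetric = toWitness {a? = all? λ u → all? λ v → templateAdj (toℕ u) (toℕ v) ≟B templateAdj (toℕ v) (toℕ u)} _
  ; irrefl    = toWitness {a? = all? λ v → templateAdj (toℕ v) (toℕ v) ≟B false} _
  }

row : ℕ → Fin 3
row 0 = zero
row 1 = suc zero
row _ = suc (suc zero)

centre : Fin 3 → Fin 15
centre zero             = # 6
centre (suc zero)       = # 7
centre (suc (suc zero)) = # 8

pick : Letter → Letter → Letter → Letter → Letter → ℕ → Letter
pick a b c d e 0 = a
pick a b c d e 1 = b
pick a b c d e 2 = c
pick a b c d e 3 = d
pick a b c d e _ = e

windowConfig : Letter → Letter → Letter → Letter → Letter → Config 15
windowConfig a b c d e u = column (pick a b c d e (toℕ u div 3)) (row (toℕ u % 3))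

fin3-ext : ∀ {A : Set} {f g : Fin 3 → A} →
  f zero ≡ g zero → f (suc zero) ≡ g (suc zero) → f (suc (suc zero)) ≡ g (suc (suc zero)) → ∀ j → f j ≡ g j
fin3-ext e₀ e₁ e₂ zero             = e₀
fin3-ext e₀ e₁ e₂ (suc zero)       = e₁
fin3-ext e₀ e₁ e₂ (suc (suc zero)) = e₂

-- All sixteen windows of five consecutive letters of the cyclic word, checked by evaluation:
-- the middle column takes over the letter of its right neighbour.
step-window : ∀ {a b c d e} → Follows a b → Follows b c → Follows c d → Follows d e →
  ∀ j → step template (windowConfig a b c d e) (centre j) ≡ column d j
step-window X→F₁  F₁→F₂ F₂→Y  Y→Z₁  = fin3-ext refl refl refl
step-window F₁→F₂ F₂→Y  Y→Z₁  Z₁→Z₂ = fin3-ext refl refl refl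
step-window F₂→Y  Y→Z₁  Z₁→Z₂ Z₂→Z₂ = fin3-ext refl refl refl
step-window F₂→Y  Y→Z₁  Z₁→Z₂ Z₂→X  = fin3-ext refl refl refl
step-window Y→Z₁  Z₁→Z₂ Z₂→Z₂ Z₂→Z₂ = fin3-ext refl refl refl
step-window Y→Z₁  Z₁→Z₂ Z₂→Z₂ Z₂→X  = fin3-ext refl refl refl
step-window Y→Z₁  Z₁→Z₂ Z₂→X  X→F₁  = fin3-ext refl refl refl
step-window Z₁→Z₂ Z₂→Z₂ Z₂→Z₂ Z₂→Z₂ = fin3-ext refl refl refl
step-window Z₁→Z₂ Z₂→Z₂ Z₂→Z₂ Z₂→X  = fin3-ext refl refl refl
step-window Z₁→Z₂ Z₂→Z₂ Z₂→X  X→F₁  = fin3-ext refl refl refl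
step-window Z₁→Z₂ Z₂→X  X→F₁  F₁→F₂ = fin3-ext refl refl refl
step-window Z₂→Z₂ Z₂→Z₂ Z₂→Z₂ Z₂→Z₂ = fin3-ext refl refl refl
step-window Z₂→Z₂ Z₂→Z₂ Z₂→Z₂ Z₂→X  = fin3-ext refl refl refl
step-window Z₂→Z₂ Z₂→Z₂ Z₂→X  X→F₁  = fin3-ext refl refl refl
step-window Z₂→Z₂ Z₂→X  X→F₁  F₁→F₂ = fin3-ext refl refl refl
step-window Z₂→X  X→F₁  F₁→F₂ F₂→Y  = fin3-ext refl refl refl

other₁ other₂ : Fin 3 → Fin 3
other₁ zero             = suc zero
other₁ (suc zero)       = zero
other₁ (suc (suc zero)) = zero
other₂ zero             = suc (suc zero)
other₂ (suc zero)       = suc (suc zero)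
other₂ (suc (suc zero)) = suc zero

other-rows : ∀ {j j′ : Fin 3} → j′ ≢ j → j′ ≡ other₁ j ⊎ j′ ≡ other₂ j
other-rows {zero}             {zero}             j′≢j = ⊥-elim (j′≢j refl)
other-rows {zero}             {suc zero}         _    = inj₁ refl
other-rows {zero}             {suc (suc zero)}   _    = inj₂ refl
other-rows {suc zero}         {zero}             _    = inj₁ refl
other-rows {suc zero}         {suc zero}         j′≢j = ⊥-elim (j′≢j refl)
other-rows {suc zero}         {suc (suc zero)}   _    = inj₂ refl
other-rows {suc (suc zero)}   {zero}             _    = inj₁ refl
other-rows {suc (suc zero)}   {suc zero}         _    = inj₂ refl
other-rows {suc (suc zero)}   {suc (suc zero)}   j′≢j = ⊥-elim (j′≢j refl)

other₁≢ : ∀ j → other₁ j ≢ j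
other₁≢ zero             ()
other₁≢ (suc zero)       ()
other₁≢ (suc (suc zero)) ()

other₂≢ : ∀ j → other₂ j ≢ j
other₂≢ zero             ()
other₂≢ (suc zero)       ()
other₂≢ (suc (suc zero)) ()

other₁≢other₂ : ∀ j → other₁ j ≢ other₂ j
other₁≢other₂ zero             ()
other₁≢other₂ (suc zero)       ()
other₁≢other₂ (suc (suc zero)) ()

module Prism (K : ℕ) where

  open Rotation (5 + K) public

  data PrismEdge : Fin L × Fin 3 → Fin L × Fin 3 → Set where
    rung   : ∀ {i j j′} → j′ ≢ j → PrismEdge (i , j) (i , j′)
    ahead  : ∀ {i j} → PrismEdge (i , j) (next i , j)
    behind : ∀ {i j} → PrismEdge (i , j) (prev i , j)

  PrismEdge-sym : ∀ {p q} → PrismEdge p q → PrismEdge q p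
  PrismEdge-sym (rung j′≢j)      = rung (j′≢j ∘ sym)
  PrismEdge-sym (ahead {i} {j})  = subst (λ i′ → PrismEdge (next i , j) (i′ , j)) (prev-next i) behind
  PrismEdge-sym (behind {i} {j}) = subst (λ i′ → PrismEdge (prev i , j) (i′ , j)) (next-prev i) ahead

  PrismEdge⇒≢ : ∀ {p q} → PrismEdge p q → p ≢ q
  PrismEdge⇒≢ (rung j′≢j)  p≡q = j′≢j (sym (cong proj₂ p≡q))
  PrismEdge⇒≢ (ahead {i})  p≡q = next≢ (s≤s (s≤s z≤n)) i (sym (cong proj₁ p≡q))
  PrismEdge⇒≢ (behind {i}) p≡q = prev≢ (s≤s (s≤s z≤n)) i (sym (cong proj₁ p≡q))

  prismEdge? : ∀ p q → Dec (PrismEdge p q)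
  prismEdge? (i , j) (i′ , j′) with j ≟F j′
  prismEdge? (i , j) (i′ , j′) | no j≢j′ with i ≟F i′
  ... | yes refl = yes (rung (j≢j′ ∘ sym))
  ... | no i≢i′  = no λ { (rung _) → i≢i′ refl ; ahead → j≢j′ refl ; behind → j≢j′ refl }
  prismEdge? (i , j) (i′ , .j) | yes refl with i′ ≟F next i | i′ ≟F prev i
  ... | yes refl | _        = yes ahead
  ... | no _     | yes refl = yes behind
  ... | no ≢next | no ≢prev = no λ { (rung j≢j) → j≢j refl ; ahead → ≢next refl ; behind → ≢prev refl }

  -- The prism C_L □ K₃, with the vertex combine i j in column i and row j.
  prism : Graph (L * 3)
  prism = record
    { adj       = λ p q → does (prismEdge? (remQuot 3 p) (remQuot 3 q))
    ; symmetric = λ p q → does-⇔ (mk⇔ PrismEdge-sym PrismEdge-sym)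
                            (prismEdge? (remQuot 3 p) (remQuot 3 q)) (prismEdge? (remQuot 3 q) (remQuot 3 p))
    ; irrefl    = λ p → dec-false (prismEdge? (remQuot 3 p) (remQuot 3 p)) (λ e → PrismEdge⇒≢ e refl)
    }

module Construction {m} (S : Graph m) (K : ℕ) where

  open Prism K public

  n : ℕ
  n = m + L * 3

  G : Graph n
  G = S ⊕ prism

  original : Fin m → Fin n
  original a = a ↑ˡ L * 3

  cell : Fin L → Fin 3 → Fin n
  cell i j = m ↑ʳ combine i j

  data Vertex : Fin n → Set where
    originalᵛ : ∀ a → Vertex (original a)
    cellᵛ     : ∀ i j → Vertex (cell i j)

  vertex : ∀ u → Vertex u
  vertex u with ⊕-view {m} {L * 3} u
  ... | left a  = originalᵛ a
  ... | right p = subst (λ q → Vertex (m ↑ʳ q)) (combine-remQuot {L} 3 p)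
                        (cellᵛ (proj₁ (remQuot {L} 3 p)) (proj₂ (remQuot {L} 3 p)))

  T-adj-cell : ∀ i j i′ j′ → T (adj G (cell i j) (cell i′ j′)) ⇔ PrismEdge (i , j) (i′ , j′)
  T-adj-cell i j i′ j′ = mk⇔
    (λ t → toWitness {a? = prismEdge? (i , j) (i′ , j′)} (subst T adj≡ t))
    (λ e → subst T (sym adj≡) (fromWitness {a? = prismEdge? (i , j) (i′ , j′)} e))
    where
    adj≡ : adj G (cell i j) (cell i′ j′) ≡ isYes (prismEdge? (i , j) (i′ , j′))
    adj≡ = ≡-trans (⊕-adjʳʳ S prism (combine i j) (combine i′ j′))
             (≡-trans (cong₂ (λ p q → does (prismEdge? p q)) (remQuot-combine i j) (remQuot-combine i′ j′))
                      (sym (isYes≗does (prismEdge? (i , j) (i′ , j′)))))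

  cell-injective : ∀ {p q} → uncurry cell p ≡ uncurry cell q → p ≡ q
  cell-injective {i , j} {i′ , j′} eq = begin
    (i , j)                         ≡⟨ remQuot-combine i j ⟨
    remQuot 3 (combine i j)         ≡⟨ cong (remQuot 3) (↑ʳ-injective m (combine i j) (combine i′ j′) eq) ⟩
    remQuot 3 (combine i′ j′)       ≡⟨ remQuot-combine i′ j′ ⟩
    (i′ , j′)                       ∎
    where open ≡-Reasoning

  prismNeighbourhood : Fin L → Fin 3 → List (Fin L × Fin 3)
  prismNeighbourhood i j = (i , j) ∷ (prev i , j) ∷ (i , other₁ j) ∷ (i , other₂ j) ∷ (next i , j) ∷ []

  prismNeighbourhood-unique : ∀ i j → Unique (prismNeighbourhood i j)
  prismNeighbourhood-unique i j =
      (≢ˡ (prev≢ 1<L i ∘ sym) ∷ ≢ʳ (other₁≢ j ∘ sym) ∷ ≢ʳ (other₂≢ j ∘ sym) ∷ ≢ˡ (next≢ 1<L i ∘ sym) ∷ [])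
    ∷ (≢ˡ (prev≢ 1<L i) ∷ ≢ˡ (prev≢ 1<L i) ∷ ≢ˡ (prev≢next 2<L i) ∷ [])
    ∷ (≢ʳ (other₁≢other₂ j) ∷ ≢ˡ (next≢ 1<L i ∘ sym) ∷ [])
    ∷ (≢ˡ (next≢ 1<L i ∘ sym) ∷ [])
    ∷ [] ∷ []
    where
    1<L : 1 < L
    1<L = s≤s (s≤s z≤n)
    2<L : 2 < L
    2<L = s≤s (s≤s (s≤s z≤n))
    ≢ˡ : ∀ {i i′ : Fin L} {j j′ : Fin 3} → i ≢ i′ → (i , j) ≢ (i′ , j′)
    ≢ˡ i≢i′ = i≢i′ ∘ cong proj₁
    ≢ʳ : ∀ {i i′ : Fin L} {j j′ : Fin 3} → j ≢ j′ → (i , j) ≢ (i′ , j′)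
    ≢ʳ j≢j′ = j≢j′ ∘ cong proj₂

  N-cell : ∀ i j → N[ G ] (cell i j) ↭ map (uncurry cell) (prismNeighbourhood i j)
  N-cell i j = unique-⇔⇒↭ (N[]-unique G (cell i j))
                 (Unique.map⁺ cell-injective (prismNeighbourhood-unique i j)) (mk⇔ to from)
    where
    neighbour : ∀ {u} → Vertex u → T (adj G (cell i j) u) → u ∈ map (uncurry cell) (prismNeighbourhood i j)
    neighbour (originalᵛ a) t = ⊥-elim (subst T (⊕-adjʳˡ S prism (combine i j) a) t)
    neighbour (cellᵛ i′ j′) t with Equivalence.to (T-adj-cell i j i′ j′) t
    ... | rung j′≢j with other-rows j′≢j
    ...   | inj₁ refl = there (there (here refl))
    ...   | inj₂ refl = there (there (there (here refl)))
    neighbour (cellᵛ i′ j′) t | ahead  = there (there (there (there (here refl))))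
    neighbour (cellᵛ i′ j′) t | behind = there (here refl)
    to : ∀ {u} → u ∈ N[ G ] (cell i j) → u ∈ map (uncurry cell) (prismNeighbourhood i j)
    to {u} u∈N with Equivalence.to (∈-N[] G) u∈N
    ... | inj₁ refl = here refl
    ... | inj₂ t    = neighbour (vertex u) t
    edge : ∀ {u} → u ∈ map (uncurry cell) (prismNeighbourhood i j) → u ≡ cell i j ⊎ T (adj G (cell i j) u)
    edge (here refl)                                 = inj₁ refl
    edge (there (here refl))                         = inj₂ (Equivalence.from (T-adj-cell i j (prev i) j) behind)
    edge (there (there (here refl)))                 = inj₂ (Equivalence.from (T-adj-cell i j i (other₁ j)) (rung (other₁≢ j)))
    edge (there (there (there (here refl))))         = inj₂ (Equivalence.from (T-adj-cell i j i (other₂ j)) (rung (other₂≢ j)))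
    edge (there (there (there (there (here refl))))) = inj₂ (Equivalence.from (T-adj-cell i j (next i) j) ahead)
    from : ∀ {u} → u ∈ map (uncurry cell) (prismNeighbourhood i j) → u ∈ N[ G ] (cell i j)
    from = Equivalence.from (∈-N[] G) ∘ edge

  cellLetter : ℕ → Fin L → Letter
  cellLetter t i = letter (toℕ (rotate t i))

  cellLetter-next : ∀ t i {i′} → next i ≡ i′ → Follows (cellLetter t i) (cellLetter t i′)
  cellLetter-next t i refl =
    subst (Follows (cellLetter t i) ∘ letter) (sym (toℕ-rotate-next t i)) (letter-suc-mod K (toℕ<n (rotate t i)))

  configAt : ℕ → Config n
  configAt t u = [ (λ _ → D) , (λ p → column (cellLetter t (proj₁ (remQuot {L} 3 p))) (proj₂ (remQuot {L} 3 p))) ]′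
                 (splitAt m u)

  configAt-original : ∀ t a → configAt t (original a) ≡ D
  configAt-original t a = cong [ (λ _ → D) , _ ]′ (splitAt-↑ˡ m a (L * 3))

  configAt-cell : ∀ t i j → configAt t (cell i j) ≡ column (cellLetter t i) j
  configAt-cell t i j = ≡-trans (cong [ (λ _ → D) , _ ]′ (splitAt-↑ʳ m (L * 3) (combine i j)))
    (cong (λ (p : Fin L × Fin 3) → column (cellLetter t (proj₁ p)) (proj₂ p)) (remQuot-combine i j))

  columnAt : Fin L → ℕ → Fin L
  columnAt i 0 = prev (prev i)
  columnAt i 1 = prev i
  columnAt i 2 = i
  columnAt i 3 = next i
  columnAt i _ = next (next i)

  embedWindow : Fin L → Fin 15 → Fin n
  embedWindow i u = cell (columnAt i (toℕ u div 3)) (row (toℕ u % 3))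

  embedWindow-centre : ∀ i j → embedWindow i (centre j) ≡ cell i j
  embedWindow-centre i zero             = refl
  embedWindow-centre i (suc zero)       = refl
  embedWindow-centre i (suc (suc zero)) = refl

  windowAt : ℕ → Fin L → Config 15
  windowAt t i = windowConfig (w 0) (w 1) (w 2) (w 3) (w 4)
    where w = cellLetter t ∘ columnAt i

  configAt-embedWindow : ∀ t i u → configAt t (embedWindow i u) ≡ windowAt t i u
  configAt-embedWindow t i u =
    ≡-trans (configAt-cell t (columnAt i (toℕ u div 3)) (row (toℕ u % 3)))
            (cong (λ l → column l (row (toℕ u % 3))) (letter-picked (toℕ u div 3)))
    where
    w = cellLetter t ∘ columnAt i
    letter-picked : ∀ c → w c ≡ pick (w 0) (w 1) (w 2) (w 3) (w 4) c
    letter-picked 0 = refl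
    letter-picked 1 = refl
    letter-picked 2 = refl
    letter-picked 3 = refl
    letter-picked (suc (suc (suc (suc _)))) = refl

  N-cell-prev : ∀ i j → N[ G ] (cell (prev i) j) ↭
    (cell (prev i) j ∷ cell (prev (prev i)) j ∷ cell (prev i) (other₁ j) ∷ cell (prev i) (other₂ j) ∷ cell i j ∷ [])
  N-cell-prev i j = subst (λ i′ → N[ G ] (cell (prev i) j) ↭
    (cell (prev i) j ∷ cell (prev (prev i)) j ∷ cell (prev i) (other₁ j) ∷ cell (prev i) (other₂ j) ∷ cell i′ j ∷ []))
    (next-prev i) (N-cell (prev i) j)

  N-cell-next : ∀ i j → N[ G ] (cell (next i) j) ↭
    (cell (next i) j ∷ cell i j ∷ cell (next i) (other₁ j) ∷ cell (next i) (other₂ j) ∷ cell (next (next i)) j ∷ [])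
  N-cell-next i j = subst (λ i′ → N[ G ] (cell (next i) j) ↭
    (cell (next i) j ∷ cell i′ j ∷ cell (next i) (other₁ j) ∷ cell (next i) (other₂ j) ∷ cell (next (next i)) j ∷ []))
    (prev-next i) (N-cell (next i) j)

  embedWindow-preserves-N[] : ∀ i j →
    All (NeighbourhoodPreserved G template (embedWindow i)) (N[ template ] (centre j))
  embedWindow-preserves-N[] i zero =
    N-cell i zero ∷ N-cell-prev i zero ∷ N-cell i (suc zero) ∷ N-cell i (suc (suc zero)) ∷ N-cell-next i zero ∷ []
  embedWindow-preserves-N[] i (suc zero) =
    N-cell i (suc zero) ∷ N-cell-prev i (suc zero) ∷ N-cell i zero ∷ N-cell i (suc (suc zero))
      ∷ N-cell-next i (suc zero) ∷ []
  embedWindow-preserves-N[] i (suc (suc zero)) =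
    N-cell i (suc (suc zero)) ∷ N-cell-prev i (suc (suc zero)) ∷ N-cell i zero ∷ N-cell i (suc zero)
      ∷ N-cell-next i (suc (suc zero)) ∷ []

  step-cell : ∀ t i j → step G (configAt t) (cell i j) ≡ configAt (suc t) (cell i j)
  step-cell t i j = begin
    step G (configAt t) (cell i j)                    ≡⟨ cong (step G (configAt t)) (embedWindow-centre i j) ⟨
    step G (configAt t) (embedWindow i (centre j))    ≡⟨ Transport.step-transport G (configAt t) template (windowAt t i)
                                                           (embedWindow i) (configAt-embedWindow t i)
                                                           (centre j) (embedWindow-preserves-N[] i j) ⟩
    step template (windowAt t i) (centre j)           ≡⟨ step-window (cellLetter-next t (prev (prev i)) (next-prev (prev i)))
                                                                     (cellLetter-next t (prev i) (next-prev i))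
                                                                     (cellLetter-next t i refl)
                                                                     (cellLetter-next t (next i) refl) j ⟩
    column (cellLetter t (next i)) j                  ≡⟨ cong (λ i′ → column (letter (toℕ i′)) j) (rotate-rotate t 1 i) ⟩
    column (cellLetter (suc t) i) j                   ≡⟨ configAt-cell (suc t) i j ⟨
    configAt (suc t) (cell i j)                       ∎
    where open ≡-Reasoning

  step-original : ∀ t a → step G (configAt t) (original a) ≡ configAt (suc t) (original a)
  step-original t a = ≡-trans (step-unanimousD G (configAt t) (original a) (All.tabulate defects))
                              (sym (configAt-original (suc t) a))
    where
    defects : ∀ {u} → u ∈ N[ G ] (original a) → configAt t u ≡ D
    defects {u} u∈N with Equivalence.to (∈-N[] G) u∈N | vertex u
    ... | inj₁ refl | _           = configAt-original t a
    ... | inj₂ _    | originalᵛ b = configAt-original t b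
    ... | inj₂ a~u  | cellᵛ i j   = ⊥-elim (subst T (⊕-adjˡʳ S prism a (combine i j)) a~u)

  step-configAt : ∀ t u → step G (configAt t) u ≡ configAt (suc t) u
  step-configAt t u with vertex u
  ... | originalᵛ a = step-original t a
  ... | cellᵛ i j   = step-cell t i j

  process-configAt : ∀ t u → process G (configAt 0) t u ≡ configAt t u
  process-configAt zero    u = refl
  process-configAt (suc t) u = ≡-trans (step-cong G (process-configAt t) u) (step-configAt t u)

  configAt-L : ∀ u → configAt L u ≡ configAt 0 u
  configAt-L u with vertex u
  ... | originalᵛ a = ≡-trans (configAt-original L a) (sym (configAt-original 0 a))
  ... | cellᵛ i j   = ≡-trans (configAt-cell L i j) (≡-trans
      (cong (λ i′ → column (letter (toℕ i′)) j) (≡-trans (rotate-L i) (sym (rotate-zero i))))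
      (sym (configAt-cell 0 i j)))

  cellLetter-unrotate : ∀ t {ℓ} → ℓ < L → cellLetter (t + ℓ) (unrotate t) ≡ letter ℓ
  cellLetter-unrotate t {ℓ} ℓ<L = cong letter (begin
    toℕ (rotate (t + ℓ) (unrotate t))        ≡⟨ cong toℕ (rotate-rotate ℓ t (unrotate t)) ⟨
    toℕ (rotate ℓ (rotate t (unrotate t)))   ≡⟨ cong (toℕ ∘ rotate ℓ) (rotate-unrotate t) ⟩
    toℕ (rotate ℓ zero)                      ≡⟨ toℕ-rotate-zero ℓ<L ⟩
    ℓ                                        ∎)
    where open ≡-Reasoning

  X-differs : ∀ r → ∃ λ j → column X j ≢ column (letter (2 + r)) j
  X-differs zero                = suc (suc zero) , λ ()
  X-differs (suc zero)          = zero , λ ()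
  X-differs (suc (suc zero))    = zero , λ ()
  X-differs (suc (suc (suc r))) = zero , λ ()

  -- The cell showing X at time t shows letter ℓ ≠ X at time t + ℓ.
  not-recurs : ∀ ℓ → 1 < ℓ → ℓ < L → ¬ Recurs G (configAt 0) ℓ
  not-recurs ℓ@(suc (suc r)) (s≤s (s≤s z≤n)) ℓ<L (t , same) = proj₂ (X-differs r) (begin
    column X j                                 ≡⟨ cong (λ i → column (letter (toℕ i)) j) (rotate-unrotate t) ⟨
    column (cellLetter t x) j                  ≡⟨ configAt-cell t x j ⟨
    configAt t (cell x j)                      ≡⟨ process-configAt t (cell x j) ⟨
    process G (configAt 0) t (cell x j)        ≡⟨ same (cell x j) ⟩
    process G (configAt 0) (t + ℓ) (cell x j)  ≡⟨ process-configAt (t + ℓ) (cell x j) ⟩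
    configAt (t + ℓ) (cell x j)                ≡⟨ configAt-cell (t + ℓ) x j ⟩
    column (cellLetter (t + ℓ) x) j            ≡⟨ cong (λ l → column l j) (cellLetter-unrotate t ℓ<L) ⟩
    column (letter ℓ) j                        ∎)
    where
    open ≡-Reasoning
    x = unrotate t
    j = proj₁ (X-differs r)

  period : PeriodIs G (configAt 0) L
  period = s≤s (s≤s z≤n)
         , (0 , λ u → ≡-trans (sym (configAt-L u)) (sym (process-configAt L u)))
         , not-recurs

mainTheorem13 : (k : ℕ) → 0 < k → (m : ℕ) (S : Graph m) →
    Σ ℕ λ n → Σ (Graph n) λ G → InducedSubgraph S G ×
      Σ (Config n) λ C₀ → Σ ℕ λ ℓ → PeriodIs G C₀ ℓ × k ≤ ℓ
mainTheorem13 k _ m S = n , G , ⊕-induced S prism , configAt 0 , L , period , m≤n+m k 6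
  where open Construction S k
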